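{- Let $l\ge1$ and let there be $n=2l+3$ balls. If all possible queries of size $2l+1$ have been asked (and answered), then we can find a non-minority ball, i.e. name a ball that is a non-minority ball of the whole set in every coloring consistent with the answers.
   Context: The balls are each colored red or blue in an unknown way. A ball $b$ is a majority ball of a set $A$ if more than $|A|/2$ balls of $A$ have the color of $b$, and a non-minority ball of $A$ if at least $|A|/2$ balls of $A$ have the color of $b$. A query is a set of balls of odd size, and the answer is (the index of) some majority ball of the query, chosen adversarially. -}

module Defs where

open import Data.Nat using (ℕ; suc; _+_; _*_; _<_; _≤_)
open import Data.Bool using (Bool)
open import Data.Bool.Properties using () renaming (_≟_ to _≟ᴮ_)
open import Data.Fin using (Fin)
open import Data.Fin.Subset using (Subset; _∈_; _∩_; ∣_∣; ⊤)
open import Data.Vec using (tabulate)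
open import Relation.Nullary.Decidable using (does)
open import Relation.Binary.PropositionalEquality using (_≡_)

Colouring : ℕ → Set
Colouring n = Fin n → Bool

sameColour : ∀ {n} → Colouring n → Fin n → Subset n
sameColour c b = tabulate (λ i → does (c i ≟ᴮ c b))

countSame : ∀ {n} → Colouring n → Subset n → Fin n → ℕ
countSame c A b = ∣ A ∩ sameColour c b ∣

IsMajority : ∀ {n} → Colouring n → Subset n → Fin n → Set
IsMajority c A b = ∣ A ∣ < 2 * countSame c A b

IsNonMinority : ∀ {n} → Colouring n → Subset n → Fin n → Set
IsNonMinority c A b = ∣ A ∣ ≤ 2 * countSame c A b


Answers : (n k : ℕ) → Set
Answers n k = (Q : Subset n) → ∣ Q ∣ ≡ k → Fin n

AnswersInQueries : ∀ {n k} → Answers n k → Set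
AnswersInQueries {n} {k} ans = (Q : Subset n) (p : ∣ Q ∣ ≡ k) → ans Q p ∈ Q

Consistent : ∀ {n k} → Answers n k → Colouring n → Set
Consistent {n} {k} ans c = (Q : Subset n) (p : ∣ Q ∣ ≡ k) → IsMajority c Q (ans Q p)

module Submission where

-- There are n = 2l+3 balls and every query omits exactly two balls i ≠ j;
-- write A(i,j) for the answer to the query omitting i and j.  Fix a
-- colouring consistent with the answers and call a ball low if its colour
-- class has at most l+1 balls; only one colour can be low, and a ball that
-- is not low is a non-minority ball.  Two counting facts govern low balls:
--   (1) if A(i,j) is low, then neither i nor j is low;
--   (2) if some answer is low and i, j are not low, then A(i,j) is low.
-- Part 1 shows, for an arbitrary answer function on pairs, that (1) and (2)
-- alone single out a ball that is not low for EVERY predicate satisfying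
-- them: consider the echo t = A(p, A(b,p)) of a ball b through p; if t ≠ b,
-- the ball A(A(b,t), b) is never low, and if b is its own echo through p₀,
-- p₁ and A(p₀,p₁) then b itself is never low.

open import Defs
open import Data.Nat using (ℕ; suc; _+_; _*_; _≤_; _<_; s≤s)
open import Data.Nat.Properties
  using (≤-trans; ≤-<-trans; ≤-reflexive; ≰⇒>; 1+n≰n; m≤m+n; n≤1+n; +-mono-≤; +-monoˡ-≤; +-suc;
         *-monoʳ-≤; *-cancelˡ-<; suc-injective; module ≤-Reasoning)
open import Data.Nat.Tactic.RingSolver using (solve-∀)
open import Data.Bool using (Bool; true; false; not)
open import Data.Bool.Properties using (¬-not) renaming (_≟_ to _≟ᴮ_)
open import Data.Fin using (Fin; zero; suc; inject≤; #_)
open import Data.Fin.Properties using (inject≤-injective; _≟_)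
open import Data.Fin.Subset using (Subset; ⊤; _∈_; _∉_; _⊆_; _∩_; ∁; _-_; ∣_∣; inside; outside)
open import Data.Fin.Subset.Properties
  using (∈⊤; ∣⊤∣≡n; ∩-identityʳ; p─⊥≡p; p─q⊆p; x∈p∧x≢y⇒x∈p-y; x∈p∩q⁺; x∈p∩q⁻; p⊆q⇒∣p∣≤∣q∣)
open import Data.Vec using ([]; _∷_; tabulate; here; there)
open import Data.Vec.Properties using (lookup∘tabulate; lookup⇒[]=; tabulate-∘; tabulate-cong)
open import Data.Product using (∃; _×_; _,_; proj₁; proj₂)
open import Data.Sum using (_⊎_; inj₁; inj₂)
open import Data.Empty using (⊥; ⊥-elim)
open import Function using (_∘_)
open import Function.Definitions using (Injective)
open import Relation.Nullary using (¬_; Dec; yes; no)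
open import Relation.Nullary.Decidable using (does; dec-true)
open import Relation.Binary.Definitions using (DecidableEquality)
open import Relation.Binary.PropositionalEquality
  using (_≡_; _≢_; refl; sym; trans; cong; subst; module ≡-Reasoning)

-- Part 1: answers to pair queries, abstractly.
-- A i j is the answer to the query omitting the distinct balls i and j;
-- it is never i or j.

module PairAnswers {Ball : Set} (_≟ᵇ_ : DecidableEquality Ball)
  (A : (i j : Ball) → i ≢ j → Ball)
  (A≢ˡ : ∀ {i j} (i≢j : i ≢ j) → A i j i≢j ≢ i)
  (A≢ʳ : ∀ {i j} (i≢j : i ≢ j) → A i j i≢j ≢ j) where

  record Minority (Low : Ball → Set) : Set where
    field
      answer-low : ∀ {i j} (i≢j : i ≢ j) → Low (A i j i≢j) → ¬ Low i × ¬ Low j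
      forced-low : ∀ {i j k m} (i≢j : i ≢ j) (k≢m : k ≢ m) →
                   Low (A k m k≢m) → ¬ Low i → ¬ Low j → Low (A i j i≢j)

  Certain : Ball → Set₁
  Certain w = ∀ {Low} → Minority Low → ¬ Low w

  reply-≢ : ∀ {i j} (i≢j : i ≢ j) → j ≢ A i j i≢j
  reply-≢ i≢j j≡a = A≢ʳ i≢j (sym j≡a)

  echo : ∀ {b p} → b ≢ p → Ball
  echo b≢p = A _ _ (reply-≢ b≢p)

  -- Were it low, b and A(b,t) would not be low by (1); then t low makes p
  -- and A(b,p) non-low by (1), against (2) for {b,p}, while t non-low makes
  -- A(b,t) low by (2).
  echo-miss-certain : ∀ {b p} (b≢p : b ≢ p) (b≢t : b ≢ echo b≢p) →
                      Certain (A (A b (echo b≢p) b≢t) b (A≢ˡ b≢t))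
  echo-miss-certain {b} {p} b≢p b≢t {Low} minority low-d =
    ¬low-a (forced-low b≢t (A≢ˡ b≢t) low-d ¬low-b ¬low-t)
    where
    open Minority minority
    ¬low-a : ¬ Low (A b (echo b≢p) b≢t)
    ¬low-a = proj₁ (answer-low (A≢ˡ b≢t) low-d)
    ¬low-b : ¬ Low b
    ¬low-b = proj₂ (answer-low (A≢ˡ b≢t) low-d)
    ¬low-t : ¬ Low (echo b≢p)
    ¬low-t low-t = proj₂ non-low (forced-low b≢p (A≢ˡ b≢t) low-d ¬low-b (proj₁ non-low))
      where
      non-low : ¬ Low p × ¬ Low (A b p b≢p)
      non-low = answer-low (reply-≢ b≢p) low-t

  -- If b is its own echo through p₀, p₁ and A(p₀,p₁), then b is certain:
  -- were b low, (1) makes these three balls non-low, against (2) for {p₀,p₁}.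
  self-echo-certain : ∀ {b p₀ p₁} (p₀≢p₁ : p₀ ≢ p₁)
    (b≢p₀ : b ≢ p₀) (b≢p₁ : b ≢ p₁) (b≢m : b ≢ A p₀ p₁ p₀≢p₁) →
    echo b≢p₀ ≡ b → echo b≢p₁ ≡ b → echo b≢m ≡ b → Certain b
  self-echo-certain {b} p₀≢p₁ b≢p₀ b≢p₁ b≢m e₀ e₁ e₂ {Low} minority low-b =
    ¬low-through b≢m e₂
      (forced-low p₀≢p₁ (reply-≢ b≢p₀) (subst Low (sym e₀) low-b)
        (¬low-through b≢p₀ e₀) (¬low-through b≢p₁ e₁))
    where
    open Minority minority
    ¬low-through : ∀ {p} (b≢p : b ≢ p) → echo b≢p ≡ b → ¬ Low p
    ¬low-through b≢p e = proj₁ (answer-low (reply-≢ b≢p) (subst Low (sym e) low-b))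

  self-echo-or-certain : ∀ {b p} (b≢p : b ≢ p) → echo b≢p ≡ b ⊎ ∃ Certain
  self-echo-or-certain {b} b≢p with echo b≢p ≟ᵇ b
  ... | yes t≡b = inj₁ t≡b
  ... | no t≢b = inj₂ (_ , echo-miss-certain b≢p (t≢b ∘ sym))

  certain-from : ∀ {b p₀ p₁} (p₀≢p₁ : p₀ ≢ p₁) →
                 b ≢ p₀ → b ≢ p₁ → b ≢ A p₀ p₁ p₀≢p₁ → ∃ Certain
  certain-from p₀≢p₁ b≢p₀ b≢p₁ b≢m
    with self-echo-or-certain b≢p₀ | self-echo-or-certain b≢p₁ | self-echo-or-certain b≢m
  ... | inj₂ found | _         | _         = found
  ... | inj₁ _     | inj₂ found | _         = found
  ... | inj₁ _     | inj₁ _     | inj₂ found = found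
  ... | inj₁ e₀    | inj₁ e₁    | inj₁ e₂    = _ , self-echo-certain p₀≢p₁ b≢p₀ b≢p₁ b≢m e₀ e₁ e₂

  -- With four distinct balls a certain ball exists: query {0,1} and take b
  -- to be ball 2, or ball 3 if the answer is ball 2.
  certain-exists : (ball : Fin 4 → Ball) → Injective _≡_ _≡_ ball → ∃ Certain
  certain-exists ball injective = choose (m ≟ᵇ ball (# 2))
    where
    apart : ∀ x y → x ≢ y → ball x ≢ ball y
    apart x y x≢y = x≢y ∘ injective
    m : Ball
    m = A (ball (# 0)) (ball (# 1)) (apart (# 0) (# 1) λ ())
    choose : Dec (m ≡ ball (# 2)) → ∃ Certain
    choose (yes m≡2) = certain-from _ (apart (# 3) (# 0) λ ()) (apart (# 3) (# 1) λ ())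
                         (λ 3≡m → apart (# 3) (# 2) (λ ()) (trans 3≡m m≡2))
    choose (no m≢2)  = certain-from _ (apart (# 2) (# 0) λ ()) (apart (# 2) (# 1) λ ()) (m≢2 ∘ sym)

-- Part 2: counting in subsets.

∣p∩q∣+∣p∩∁q∣≡∣p∣ : ∀ {n} (p q : Subset n) → ∣ p ∩ q ∣ + ∣ p ∩ ∁ q ∣ ≡ ∣ p ∣
∣p∩q∣+∣p∩∁q∣≡∣p∣ []            []            = refl
∣p∩q∣+∣p∩∁q∣≡∣p∣ (inside  ∷ p) (inside  ∷ q) = cong suc (∣p∩q∣+∣p∩∁q∣≡∣p∣ p q)
∣p∩q∣+∣p∩∁q∣≡∣p∣ (inside  ∷ p) (outside ∷ q) =
  trans (+-suc ∣ p ∩ q ∣ _) (cong suc (∣p∩q∣+∣p∩∁q∣≡∣p∣ p q))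
∣p∩q∣+∣p∩∁q∣≡∣p∣ (outside ∷ p) (_       ∷ q) = ∣p∩q∣+∣p∩∁q∣≡∣p∣ p q

∣p∩q∣≡1+∣p-x∩q∣ : ∀ {n} {x : Fin n} (p q : Subset n) → x ∈ p → x ∈ q →
                  ∣ p ∩ q ∣ ≡ suc ∣ (p - x) ∩ q ∣
∣p∩q∣≡1+∣p-x∩q∣ (inside ∷ p) (inside ∷ q) here here =
  cong (λ r → suc ∣ r ∩ q ∣) (sym (p─⊥≡p p))
∣p∩q∣≡1+∣p-x∩q∣ (inside  ∷ p) (inside  ∷ q) (there x∈p) (there x∈q) =
  cong suc (∣p∩q∣≡1+∣p-x∩q∣ p q x∈p x∈q)
∣p∩q∣≡1+∣p-x∩q∣ (inside  ∷ p) (outside ∷ q) (there x∈p) (there x∈q) = ∣p∩q∣≡1+∣p-x∩q∣ p q x∈p x∈q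
∣p∩q∣≡1+∣p-x∩q∣ (outside ∷ p) (_       ∷ q) (there x∈p) (there x∈q) = ∣p∩q∣≡1+∣p-x∩q∣ p q x∈p x∈q

∣p∣≡1+∣p-x∣ : ∀ {n} {x : Fin n} (p : Subset n) → x ∈ p → ∣ p ∣ ≡ suc ∣ p - x ∣
∣p∣≡1+∣p-x∣ {x = x} p x∈p = begin
  ∣ p ∣                  ≡⟨ cong ∣_∣ (sym (∩-identityʳ p)) ⟩
  ∣ p ∩ ⊤ ∣              ≡⟨ ∣p∩q∣≡1+∣p-x∩q∣ p ⊤ x∈p ∈⊤ ⟩
  suc ∣ (p - x) ∩ ⊤ ∣    ≡⟨ cong (suc ∘ ∣_∣) (∩-identityʳ (p - x)) ⟩
  suc ∣ p - x ∣          ∎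
  where open ≡-Reasoning

∣p∩q∣-monoˡ : ∀ {n} {p p′ : Subset n} (q : Subset n) → p ⊆ p′ → ∣ p ∩ q ∣ ≤ ∣ p′ ∩ q ∣
∣p∩q∣-monoˡ {p = p} q p⊆p′ = p⊆q⇒∣p∣≤∣q∣ λ x∈p∩q →
  x∈p∩q⁺ (p⊆p′ (proj₁ (x∈p∩q⁻ p q x∈p∩q)) , proj₂ (x∈p∩q⁻ p q x∈p∩q))

x∉p-x : ∀ {n} {x : Fin n} (p : Subset n) → x ∉ p - x
x∉p-x {x = zero}  (_ ∷ p) ()
x∉p-x {x = suc x} (_ ∷ p) (there x∈p-x) = x∉p-x p x∈p-x

x∈p-y⇒x≢y : ∀ {n} {x y : Fin n} {p : Subset n} → x ∈ p - y → x ≢ y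
x∈p-y⇒x≢y {p = p} x∈p-x refl = x∉p-x p x∈p-x

-- Part 3: colour classes and pair queries.

colourClass : ∀ {n} → Colouring n → Bool → Subset n
colourClass c x = tabulate (λ k → does (c k ≟ᴮ x))

countColour : ∀ {n} → Colouring n → Subset n → Bool → ℕ
countColour c p x = ∣ p ∩ colourClass c x ∣

does-≟-not : ∀ a b → not (does (a ≟ᴮ b)) ≡ does (a ≟ᴮ not b)
does-≟-not true  true  = refl
does-≟-not true  false = refl
does-≟-not false true  = refl
does-≟-not false false = refl

∈colourClass : ∀ {n} (c : Colouring n) (k : Fin n) → k ∈ colourClass c (c k)
∈colourClass c k = lookup⇒[]= k _ (trans (lookup∘tabulate _ k) (dec-true (c k ≟ᴮ c k) refl))

∁colourClass : ∀ {n} (c : Colouring n) (x : Bool) → ∁ (colourClass c x) ≡ colourClass c (not x)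
∁colourClass c x = trans (sym (tabulate-∘ not _)) (tabulate-cong λ k → does-≟-not (c k) x)

countColour-split : ∀ {n} (c : Colouring n) (p : Subset n) (x : Bool) →
                    countColour c p x + countColour c p (not x) ≡ ∣ p ∣
countColour-split c p x =
  trans (cong (λ r → countColour c p x + ∣ p ∩ r ∣) (sym (∁colourClass c x)))
        (∣p∩q∣+∣p∩∁q∣≡∣p∣ p (colourClass c x))

countColour-remove : ∀ {n} (c : Colouring n) {k : Fin n} {x : Bool} (p : Subset n) →
                     k ∈ p → c k ≡ x → countColour c p x ≡ suc (countColour c (p - k) x)
countColour-remove c {k} p k∈p refl = ∣p∩q∣≡1+∣p-x∩q∣ p _ k∈p (∈colourClass c k)

pairQuery : ∀ {n} → Fin n → Fin n → Subset n
pairQuery i j = ⊤ - i - j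

j∈⊤-i : ∀ {n} {i j : Fin n} → i ≢ j → j ∈ ⊤ - i
j∈⊤-i i≢j = x∈p∧x≢y⇒x∈p-y ∈⊤ (i≢j ∘ sym)

pairQuery-size : ∀ {n} {i j : Fin n} → i ≢ j → n ≡ 2 + ∣ pairQuery i j ∣
pairQuery-size {n} {i} {j} i≢j = begin
  n                     ≡⟨ sym (∣⊤∣≡n n) ⟩
  ∣ ⊤ {n} ∣             ≡⟨ ∣p∣≡1+∣p-x∣ {x = i} ⊤ ∈⊤ ⟩
  suc ∣ ⊤ - i ∣         ≡⟨ cong suc (∣p∣≡1+∣p-x∣ (⊤ - i) (j∈⊤-i i≢j)) ⟩
  2 + ∣ pairQuery i j ∣ ∎
  where open ≡-Reasoning

module _ {n} (c : Colouring n) {i j : Fin n} {x : Bool} where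

  query-within : countColour c (pairQuery i j) x ≤ countColour c ⊤ x
  query-within = ∣p∩q∣-monoˡ {p = pairQuery i j} (colourClass c x) λ _ → ∈⊤

  query+i : c i ≡ x → suc (countColour c (pairQuery i j) x) ≤ countColour c ⊤ x
  query+i ci≡x = begin
    suc (countColour c (⊤ - i - j) x) ≤⟨ s≤s (∣p∩q∣-monoˡ {p = ⊤ - i - j} (colourClass c x) (p─q⊆p (⊤ - i) _)) ⟩
    suc (countColour c (⊤ - i) x)     ≡⟨ countColour-remove c ⊤ ∈⊤ ci≡x ⟨
    countColour c ⊤ x                 ∎
    where open ≤-Reasoning

  query+j : i ≢ j → c j ≡ x → suc (countColour c (pairQuery i j) x) ≤ countColour c ⊤ x
  query+j i≢j cj≡x = begin
    suc (countColour c (⊤ - i - j) x) ≡⟨ countColour-remove c (⊤ - i) (j∈⊤-i i≢j) cj≡x ⟨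
    countColour c (⊤ - i) x           ≤⟨ ∣p∩q∣-monoˡ {p = ⊤ - i} (colourClass c x) (p─q⊆p ⊤ _) ⟩
    countColour c ⊤ x                 ∎
    where open ≤-Reasoning

  query+ij : i ≢ j → c i ≡ x → c j ≡ x → 2 + countColour c (pairQuery i j) x ≤ countColour c ⊤ x
  query+ij i≢j ci≡x cj≡x = ≤-reflexive (begin
    2 + countColour c (⊤ - i - j) x   ≡⟨ cong suc (countColour-remove c (⊤ - i) (j∈⊤-i i≢j) cj≡x) ⟨
    suc (countColour c (⊤ - i) x)     ≡⟨ countColour-remove c ⊤ ∈⊤ ci≡x ⟨
    countColour c ⊤ x                 ∎)
    where open ≡-Reasoning

-- Part 4: arithmetic for n = 2l+3 balls and queries of size 2l+1.

majority-threshold : ∀ l m → 2 * l + 1 < 2 * m → suc l ≤ m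
majority-threshold l m 2l+1<2m = *-cancelˡ-< 2 l m (≤-<-trans (m≤m+n (2 * l) 1) 2l+1<2m)

2l+3≡2+[2l+1] : ∀ l → 2 * l + 3 ≡ 2 + (2 * l + 1)
2l+3≡2+[2l+1] = solve-∀

2l+3≡1+[l+1]+[l+1] : ∀ l → 2 * l + 3 ≡ suc (suc l + suc l)
2l+3≡1+[l+1]+[l+1] = solve-∀

1+[2l+3]≡[l+1]+[l+3] : ∀ l → suc (2 * l + 3) ≡ suc l + suc (suc (suc l))
1+[2l+3]≡[l+1]+[l+3] = solve-∀

1+[2l+3]≡2[l+2] : ∀ l → suc (2 * l + 3) ≡ 2 * suc (suc l)
1+[2l+3]≡2[l+2] = solve-∀

non-minority-threshold : ∀ l m → suc (suc l) ≤ m → 2 * l + 3 ≤ 2 * m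
non-minority-threshold l m l+2≤m =
  ≤-trans (n≤1+n _) (≤-trans (≤-reflexive (1+[2l+3]≡2[l+2] l)) (*-monoʳ-≤ 2 l+2≤m))

small-halves : ∀ l {a b} → a + b ≡ 2 * l + 3 → a ≤ suc l → b ≤ suc l → ⊥
small-halves l {a} {b} a+b≡n a≤l+1 b≤l+1 = 1+n≰n (begin
  suc (suc l + suc l) ≡⟨ 2l+3≡1+[l+1]+[l+1] l ⟨
  2 * l + 3           ≡⟨ a+b≡n ⟨
  a + b               ≤⟨ +-mono-≤ a≤l+1 b≤l+1 ⟩
  suc l + suc l       ∎)
  where open ≤-Reasoning

large-halves : ∀ l {a b} → a + b ≡ 2 * l + 3 → suc l ≤ a → suc (suc (suc l)) ≤ b → ⊥
large-halves l {a} {b} a+b≡n l+1≤a l+3≤b = 1+n≰n (begin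
  suc (2 * l + 3)             ≡⟨ 1+[2l+3]≡[l+1]+[l+3] l ⟩
  suc l + suc (suc (suc l))   ≤⟨ +-mono-≤ l+1≤a l+3≤b ⟩
  a + b                       ≡⟨ a+b≡n ⟩
  2 * l + 3                   ∎)
  where open ≤-Reasoning

-- Part 5: the answers to all queries of size 2l+1 among 2l+3 balls.

module Queries (l : ℕ) (ans : Answers (2 * l + 3) (2 * l + 1)) (inQ : AnswersInQueries ans) where

  query-size : ∀ {i j : Fin (2 * l + 3)} → i ≢ j → ∣ pairQuery i j ∣ ≡ 2 * l + 1
  query-size i≢j =
    suc-injective (suc-injective (trans (sym (pairQuery-size i≢j)) (2l+3≡2+[2l+1] l)))

  A : (i j : Fin (2 * l + 3)) → i ≢ j → Fin (2 * l + 3)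
  A i j i≢j = ans (pairQuery i j) (query-size i≢j)

  A∈query : ∀ {i j} (i≢j : i ≢ j) → A i j i≢j ∈ pairQuery i j
  A∈query i≢j = inQ _ (query-size i≢j)

  A≢ˡ : ∀ {i j} (i≢j : i ≢ j) → A i j i≢j ≢ i
  A≢ˡ i≢j = x∈p-y⇒x≢y (p─q⊆p _ _ (A∈query i≢j))

  A≢ʳ : ∀ {i j} (i≢j : i ≢ j) → A i j i≢j ≢ j
  A≢ʳ i≢j = x∈p-y⇒x≢y (A∈query i≢j)

  open PairAnswers _≟_ A A≢ˡ A≢ʳ public

  module ConsistentColouring (c : Colouring (2 * l + 3)) (consistent : Consistent ans c) where

    Small : Bool → Set
    Small x = countColour c ⊤ x ≤ suc l

    Low : Fin (2 * l + 3) → Set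
    Low w = Small (c w)

    classes-sum : ∀ x → countColour c ⊤ x + countColour c ⊤ (not x) ≡ 2 * l + 3
    classes-sum x = trans (countColour-split c ⊤ x) (∣⊤∣≡n _)

    other-colour : ∀ {x y} → Small x → ¬ Small y → y ≡ not x
    other-colour small-x ¬small-y = ¬-not λ y≡x → ¬small-y (subst Small (sym y≡x) small-x)

    answer-support : ∀ {i j} (i≢j : i ≢ j) → suc l ≤ countColour c (pairQuery i j) (c (A i j i≢j))
    answer-support {i} {j} i≢j = majority-threshold l _
      (subst (λ s → s < 2 * countColour c (pairQuery i j) (c (A i j i≢j)))
             (query-size i≢j) (consistent (pairQuery i j) (query-size i≢j)))

    -- Property (1): a ball of the answer's colour outside the query would
    -- lift a small answer colour above l+1, and a ball of the other colour
    -- is not low since both colours cannot be small.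
    answer-low : ∀ {i j} (i≢j : i ≢ j) → Low (A i j i≢j) → ¬ Low i × ¬ Low j
    answer-low {i} {j} i≢j low-a = outside-not-low (query+i c) , outside-not-low (query+j c i≢j)
      where
      a : Fin (2 * l + 3)
      a = A i j i≢j
      outside-not-low : ∀ {k} →
        (c k ≡ c a → suc (countColour c (pairQuery i j) (c a)) ≤ countColour c ⊤ (c a)) → ¬ Low k
      outside-not-low {k} omitted low-k with c k ≟ᴮ c a
      ... | yes same  = 1+n≰n (≤-trans (s≤s (answer-support i≢j)) (≤-trans (omitted same) low-a))
      ... | no differ =
        small-halves l (classes-sum (c a)) low-a (subst Small (¬-not differ) low-k)

    -- Property (2): the small colour x has at least l+1 balls (it holds an
    -- answer), and i, j have the other colour; if A(i,j) had it too, that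
    -- colour would have at least l+3 balls, too many for 2l+3 balls.
    forced-low : ∀ {i j k m} (i≢j : i ≢ j) (k≢m : k ≢ m) →
                 Low (A k m k≢m) → ¬ Low i → ¬ Low j → Low (A i j i≢j)
    forced-low {i} {j} {k} {m} i≢j k≢m low-b ¬low-i ¬low-j with c (A i j i≢j) ≟ᴮ c (A k m k≢m)
    ... | yes same  = subst Small (sym same) low-b
    ... | no differ = ⊥-elim (large-halves l (classes-sum x) x-large y-larger)
      where
      x : Bool
      x = c (A k m k≢m)
      y≡not-x : c (A i j i≢j) ≡ not x
      y≡not-x = ¬-not differ
      x-large : suc l ≤ countColour c ⊤ x
      x-large = ≤-trans (answer-support k≢m) (query-within c)
      y-larger : suc (suc (suc l)) ≤ countColour c ⊤ (not x)
      y-larger = subst (λ y → suc (suc (suc l)) ≤ countColour c ⊤ y) y≡not-x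
        (≤-trans (s≤s (s≤s (answer-support i≢j)))
                 (query+ij c i≢j (trans (other-colour low-b ¬low-i) (sym y≡not-x))
                                 (trans (other-colour low-b ¬low-j) (sym y≡not-x))))

    minority : Minority Low
    minority = record { answer-low = answer-low ; forced-low = forced-low }

    non-minority : ∀ {w} → ¬ Low w → IsNonMinority c ⊤ w
    non-minority {w} ¬low = subst (λ s → s ≤ 2 * countColour c ⊤ (c w)) (sym (∣⊤∣≡n (2 * l + 3)))
      (non-minority-threshold l _ (≰⇒> ¬low))

-- The theorem: four distinct balls exist since l ≥ 1, so Part 1 yields a
-- certain ball, which by Part 5 is non-minority in every consistent colouring.

lemma13 : (l : ℕ) → 1 ≤ l →
    (ans : Answers (2 * l + 3) (2 * l + 1)) →
    AnswersInQueries ans →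
    (∃ λ c → Consistent ans c) →
    ∃ λ (b : Fin (2 * l + 3)) →
      (c : Colouring (2 * l + 3)) → Consistent ans c → IsNonMinority c ⊤ b
lemma13 l 1≤l ans inQ _ =
  proj₁ found , λ c consistent →
    ConsistentColouring.non-minority c consistent (proj₂ found (ConsistentColouring.minority c consistent))
  where
  open Queries l ans inQ
  4≤n : 4 ≤ 2 * l + 3
  4≤n = +-monoˡ-≤ 3 (≤-trans 1≤l (m≤m+n l (l + 0)))
  found : ∃ Certain
  found = certain-exists (λ k → inject≤ k 4≤n) (inject≤-injective 4≤n 4≤n _ _)
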